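{- Let $c$ be a positive integer and let $(L,Q_1,\ldots,Q_n,R)$ be a $(4,c)$-flexipath in a matroid $M$. If $n\ge 2$, then $\sqcap(L,R)+\sqcap^*(L,R)\le 5-c$.
   Context: Let $M$ be a matroid on ground set $E$ with rank function $r$. $\lambda(A)=r(A)+r(E-A)-r(M)$; for disjoint $X,Y$, $\sqcap(X,Y)=r(X)+r(Y)-r(X\cup Y)$ and $\sqcap^*(X,Y)$ is the same quantity in $M^*$; $\kappa(X,Y)=\min\{\lambda(Z):X\subseteq Z\subseteq E-Y\}$. A path of $4$-separations is an ordered partition $(L,P_1,\ldots,P_n,R)$ of $E$ with $\kappa(L,R)=3$ and $\lambda(L\cup P_1\cup\cdots\cup P_i)=3$ for all $i\in\{0,\ldots,n\}$; a $4$-flexipath if this holds for every reordering of $P_1,\ldots,P_n$ (with $L,R$ fixed); a $(4,c)$-flexipath if moreover $\lambda(P_i)=c$ for all $i$ and $\lambda(P_i\cup P_j)>c$ for all distinct $i,j$. -}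

module Defs where

open import Data.Nat as ℕ using (ℕ; zero; suc)
open import Data.Integer as ℤ using (ℤ; +_; _-_; _+_)
open import Data.Fin using (Fin; toℕ)
open import Data.Fin.Subset using (Subset; _⊆_; _∪_; _∩_; ∁; ∣_∣; ⊥; ⊤; _∈_; _∉_)
open import Data.Fin.Permutation using (Permutation′; _⟨$⟩ʳ_)
open import Data.Product using (Σ; _×_; ∃)
open import Relation.Binary.PropositionalEquality using (_≡_; _≢_)
open import Level using (0ℓ)

record Matroid (m : ℕ) : Set where
  field
    r          : Subset m → ℕ
    r-bounded  : ∀ X → r X ℕ.≤ ∣ X ∣
    r-mono     : ∀ X Y → X ⊆ Y → r X ℕ.≤ r Y
    r-submod   : ∀ X Y → r (X ∪ Y) ℕ.+ r (X ∩ Y) ℕ.≤ r X ℕ.+ r Y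

module _ {m : ℕ} (M : Matroid m) where
  open Matroid M

  rk : Subset m → ℤ
  rk X = + r X

  rM : ℤ
  rM = rk ⊤

  rk* : Subset m → ℤ
  rk* X = + ∣ X ∣ + rk (∁ X) - rM

  conn : Subset m → ℤ
  conn A = rk A + rk (∁ A) - rM

  ⊓ : Subset m → Subset m → ℤ
  ⊓ X Y = rk X + rk Y - rk (X ∪ Y)

  ⊓* : Subset m → Subset m → ℤ
  ⊓* X Y = rk* X + rk* Y - rk* (X ∪ Y)

  -- κ(X,Y) = k, i.e. k is the minimum of λ(Z) over X ⊆ Z ⊆ E - Y
  κ≡ : Subset m → Subset m → ℤ → Set
  κ≡ X Y k =
    (∃ λ Z → X ⊆ Z × Z ⊆ ∁ Y × conn Z ≡ k) ×
    (∀ Z → X ⊆ Z → Z ⊆ ∁ Y → k ℤ.≤ conn Z)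

-- union of the first k members of a finite family: f 0 ∪ ... ∪ f (k-1)
-- (all members if k ≥ n)
firsts : ∀ {m n} → (Fin n → Subset m) → ℕ → Subset m
firsts {n = zero}  f k       = ⊥
firsts {n = suc n} f zero    = ⊥
firsts {n = suc n} f (suc k) = f Fin.zero ∪ firsts (λ i → f (Fin.suc i)) k

IsOrderedPartition : ∀ {m n} → Subset m → (Fin n → Subset m) → Subset m → Set
IsOrderedPartition {m} {n} L P R =
  (∀ (x : Fin m) → x ∈ L → x ∉ R) ×
  (∀ (x : Fin m) (i : Fin n) → x ∈ P i → x ∉ L) ×
  (∀ (x : Fin m) (i : Fin n) → x ∈ P i → x ∉ R) ×
  (∀ (x : Fin m) (i j : Fin n) → i ≢ j → x ∈ P i → x ∉ P j) ×
  (L ∪ firsts P n ∪ R ≡ ⊤)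

module _ {m : ℕ} (M : Matroid m) where

  IsPath4 : ∀ {n} → Subset m → (Fin n → Subset m) → Subset m → Set
  IsPath4 {n} L P R =
    IsOrderedPartition L P R ×
    κ≡ M L R (+ 3) ×
    (∀ (i : ℕ) → i ℕ.≤ n → conn M (L ∪ firsts P i) ≡ + 3)

  IsFlexipath4 : ∀ {n} → Subset m → (Fin n → Subset m) → Subset m → Set
  IsFlexipath4 {n} L P R =
    ∀ (σ : Permutation′ n) → IsPath4 L (λ i → P (σ ⟨$⟩ʳ i)) R

  IsFlexipath4c : ℕ → ∀ {n} → Subset m → (Fin n → Subset m) → Subset m → Set
  IsFlexipath4c c {n} L P R =
    IsFlexipath4 L P R ×
    (∀ (i : Fin n) → conn M (P i) ≡ + c) ×
    (∀ (i j : Fin n) → i ≢ j → + c ℤ.< conn M (P i ∪ P j))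

{-# OPTIONS --safe #-}
module Submission where

-- For disjoint X and Y, ⊓(X,Y) + ⊓*(X,Y) = λ(X) + λ(Y) - λ(X ∪ Y).  Put
-- S = Q₁ ∪ Q₂ and F = E - (L ∪ R).  Then λ(R) = λ(F ∪ (L ∪ S)), λ(L ∪ R) = λ(F)
-- and F ∩ (L ∪ S) = S, so submodularity of λ gives
-- λ(R) - λ(L ∪ R) ≤ λ(L ∪ S) - λ(S), whence
-- ⊓(L,R) + ⊓*(L,R) ≤ λ(L) + λ(L ∪ Q₁ ∪ Q₂) - λ(Q₁ ∪ Q₂) ≤ 3 + 3 - (c + 1).

open import Defs
open import Data.Nat using (ℕ; _≤_)
open import Data.Integer using (+_; _-_; _+_) renaming (_≤_ to _≤ℤ_)
open import Data.Fin using (Fin)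
open import Data.Fin.Subset using (Subset)

import Data.Nat as ℕ
open import Data.Nat using (suc; z≤n; s≤s)
import Data.Nat.Properties as ℕ
open import Data.Integer using (ℤ; -_; 1ℤ; +≤+; _<_)
open import Data.Integer.Properties
  using (pos-+; +-assoc; +-comm; +-monoˡ-≤; +-monoʳ-≤; +-mono-≤; neg-mono-≤; i<j⇒suc[i]≤j;
         module ≤-Reasoning)
open import Data.Integer.Tactic.RingSolver using (solve-∀)
open import Data.Fin using () renaming (zero to fzero; suc to fsuc)
open import Data.Fin.Subset using (_∪_; _∩_; ∁; ∣_∣; _∈_; _∉_; _⊆_; inside; outside) renaming (⊥ to ∅)
open import Data.Fin.Subset.Properties
  using (_∈?_; x∈p∪q⁺; x∈p∪q⁻; x∈p∩q⁺; x∈p∩q⁻; x∉p⇒x∈∁p; x∈∁p⇒x∉p; p⊆q⇒∁p⊇∁q; p⊆p∪q; q⊆p∪q;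
         ⊆-antisym; Empty-unique; ∣⊥∣≡0; ∪-identityʳ; ∪-∩-booleanAlgebra)
import Algebra.Lattice.Properties.BooleanAlgebra as BooleanAlgebraProperties
open import Data.Fin.Permutation using (id)
open import Data.Product using (_,_)
open import Data.Sum using (inj₁; inj₂; [_,_])
open import Data.Vec using (_∷_; [])
open import Relation.Nullary using (yes; no; contradiction)
open import Relation.Binary.PropositionalEquality
  using (_≡_; refl; sym; trans; cong; cong₂; subst; subst₂; module ≡-Reasoning)

Disjoint : ∀ {n} → Subset n → Subset n → Set
Disjoint p q = ∀ x → x ∈ p → x ∉ q

∣p∪q∣+∣p∩q∣≡∣p∣+∣q∣ : ∀ {n} (p q : Subset n) → ∣ p ∪ q ∣ ℕ.+ ∣ p ∩ q ∣ ≡ ∣ p ∣ ℕ.+ ∣ q ∣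
∣p∪q∣+∣p∩q∣≡∣p∣+∣q∣ []            []            = refl
∣p∪q∣+∣p∩q∣≡∣p∣+∣q∣ (inside  ∷ p) (inside  ∷ q) =
  cong suc (trans (ℕ.+-suc _ _) (trans (cong suc (∣p∪q∣+∣p∩q∣≡∣p∣+∣q∣ p q)) (sym (ℕ.+-suc _ _))))
∣p∪q∣+∣p∩q∣≡∣p∣+∣q∣ (inside  ∷ p) (outside ∷ q) = cong suc (∣p∪q∣+∣p∩q∣≡∣p∣+∣q∣ p q)
∣p∪q∣+∣p∩q∣≡∣p∣+∣q∣ (outside ∷ p) (inside  ∷ q) =
  trans (cong suc (∣p∪q∣+∣p∩q∣≡∣p∣+∣q∣ p q)) (sym (ℕ.+-suc _ _))
∣p∪q∣+∣p∩q∣≡∣p∣+∣q∣ (outside ∷ p) (outside ∷ q) = ∣p∪q∣+∣p∩q∣≡∣p∣+∣q∣ p q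

Disjoint⇒p∩q≡∅ : ∀ {n} {p q : Subset n} → Disjoint p q → p ∩ q ≡ ∅
Disjoint⇒p∩q≡∅ {p = p} {q} p#q = Empty-unique λ where
  (x , x∈p∩q) → let x∈p , x∈q = x∈p∩q⁻ p q x∈p∩q in p#q x x∈p x∈q

Disjoint⇒∣p∪q∣≡∣p∣+∣q∣ : ∀ {n} {p q : Subset n} → Disjoint p q → ∣ p ∪ q ∣ ≡ ∣ p ∣ ℕ.+ ∣ q ∣
Disjoint⇒∣p∪q∣≡∣p∣+∣q∣ {n} {p} {q} p#q = begin
  ∣ p ∪ q ∣                ≡⟨ ℕ.+-identityʳ _ ⟨
  ∣ p ∪ q ∣ ℕ.+ 0          ≡⟨ cong (∣ p ∪ q ∣ ℕ.+_) ∣p∩q∣≡0 ⟨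
  ∣ p ∪ q ∣ ℕ.+ ∣ p ∩ q ∣  ≡⟨ ∣p∪q∣+∣p∩q∣≡∣p∣+∣q∣ p q ⟩
  ∣ p ∣ ℕ.+ ∣ q ∣          ∎
  where
  open ≡-Reasoning
  ∣p∩q∣≡0 : ∣ p ∩ q ∣ ≡ 0
  ∣p∩q∣≡0 = trans (cong ∣_∣ (Disjoint⇒p∩q≡∅ p#q)) (∣⊥∣≡0 n)

Disjoint-∪ˡ : ∀ {n} {p q r : Subset n} → Disjoint p r → Disjoint q r → Disjoint (p ∪ q) r
Disjoint-∪ˡ {p = p} {q} p#r q#r x x∈p∪q = [ p#r x , q#r x ] (x∈p∪q⁻ p q x∈p∪q)

Disjoint-∪ʳ : ∀ {n} {p q r : Subset n} → Disjoint p q → Disjoint p r → Disjoint p (q ∪ r)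
Disjoint-∪ʳ {q = q} {r} p#q p#r x x∈p x∈q∪r = [ p#q x x∈p , p#r x x∈p ] (x∈p∪q⁻ q r x∈q∪r)

Disjoint⇒⊆∁ : ∀ {n} {p q : Subset n} → Disjoint p q → p ⊆ ∁ q
Disjoint⇒⊆∁ p#q {x} x∈p = x∉p⇒x∈∁p (p#q x x∈p)

module _ {n} {L R S : Subset n} (L#R : Disjoint L R) (S#L : Disjoint S L) (S#R : Disjoint S R) where

  ∁[L∪R]∪[L∪S]≡∁R : ∁ (L ∪ R) ∪ (L ∪ S) ≡ ∁ R
  ∁[L∪R]∪[L∪S]≡∁R = ⊆-antisym ⊆∁R ∁R⊆
    where
    ⊆∁R : ∁ (L ∪ R) ∪ (L ∪ S) ⊆ ∁ R
    ⊆∁R {x} x∈ = [ p⊆q⇒∁p⊇∁q (q⊆p∪q L R) , Disjoint⇒⊆∁ (Disjoint-∪ˡ L#R S#R) ]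
                 (x∈p∪q⁻ (∁ (L ∪ R)) (L ∪ S) x∈)
    ∁R⊆ : ∁ R ⊆ ∁ (L ∪ R) ∪ (L ∪ S)
    ∁R⊆ {x} x∈∁R with x ∈? L
    ... | yes x∈L = x∈p∪q⁺ (inj₂ (p⊆p∪q S x∈L))
    ... | no  x∉L = x∈p∪q⁺ (inj₁ (x∉p⇒x∈∁p (λ x∈L∪R → [ x∉L , x∈∁p⇒x∉p x∈∁R ] (x∈p∪q⁻ L R x∈L∪R))))

  ∁[L∪R]∩[L∪S]≡S : ∁ (L ∪ R) ∩ (L ∪ S) ≡ S
  ∁[L∪R]∩[L∪S]≡S = ⊆-antisym ⊆S S⊆
    where
    ⊆S : ∁ (L ∪ R) ∩ (L ∪ S) ⊆ S
    ⊆S {x} x∈ with x∈p∩q⁻ (∁ (L ∪ R)) (L ∪ S) x∈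
    ... | x∈∁[L∪R] , x∈L∪S = [ x∈L⇒x∈S , (λ x∈S → x∈S) ] (x∈p∪q⁻ L S x∈L∪S)
      where
      x∈L⇒x∈S : x ∈ L → x ∈ S
      x∈L⇒x∈S x∈L = contradiction (p⊆p∪q R x∈L) (x∈∁p⇒x∉p x∈∁[L∪R])
    S⊆ : S ⊆ ∁ (L ∪ R) ∩ (L ∪ S)
    S⊆ {x} x∈S = x∈p∩q⁺ (Disjoint⇒⊆∁ (Disjoint-∪ʳ S#L S#R) x∈S , q⊆p∪q L S x∈S)

i+j≤k+l⇒i-k≤l-j : ∀ {i j k l : ℤ} → i + j ≤ℤ k + l → i - k ≤ℤ l - j
i+j≤k+l⇒i-k≤l-j {i} {j} {k} {l} i+j≤k+l = begin
  i - k              ≡⟨ shift i j k ⟩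
  i + j - (k + j)    ≤⟨ +-monoˡ-≤ (- (k + j)) i+j≤k+l ⟩
  k + l - (k + j)    ≡⟨ cancel k l j ⟩
  l - j              ∎
  where
  open ≤-Reasoning
  shift : ∀ i j k → i - k ≡ i + j - (k + j)
  shift = solve-∀
  cancel : ∀ k l j → k + l - (k + j) ≡ l - j
  cancel = solve-∀

firsts[0]≡∅ : ∀ {m n} (P : Fin n → Subset m) → firsts P 0 ≡ ∅
firsts[0]≡∅ {n = 0}     P = refl
firsts[0]≡∅ {n = suc _} P = refl

firsts[2]≡P₀∪P₁ : ∀ {m k} (P : Fin (suc (suc k)) → Subset m) → firsts P 2 ≡ P fzero ∪ P (fsuc fzero)
firsts[2]≡P₀∪P₁ P =
  cong (P fzero ∪_) (trans (cong (P (fsuc fzero) ∪_) (firsts[0]≡∅ (λ i → P (fsuc (fsuc i)))))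
                           (∪-identityʳ (P (fsuc fzero))))

module _ {m} (M : Matroid m) where
  open Matroid M
  open BooleanAlgebraProperties (∪-∩-booleanAlgebra m) using (¬-involutive; deMorgan₁; deMorgan₂)

  rk-submodular : ∀ X Y → rk M (X ∪ Y) + rk M (X ∩ Y) ≤ℤ rk M X + rk M Y
  rk-submodular X Y =
    subst₂ _≤ℤ_ (pos-+ (r (X ∪ Y)) (r (X ∩ Y))) (pos-+ (r X) (r Y)) (+≤+ (r-submod X Y))

  conn-∁ : ∀ A → conn M (∁ A) ≡ conn M A
  conn-∁ A = begin
    rk M (∁ A) + rk M (∁ (∁ A)) - rM M  ≡⟨ cong (λ B → rk M (∁ A) + rk M B - rM M) (¬-involutive A) ⟩
    rk M (∁ A) + rk M A - rM M          ≡⟨ cong (_- rM M) (+-comm (rk M (∁ A)) (rk M A)) ⟩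
    rk M A + rk M (∁ A) - rM M          ∎
    where open ≡-Reasoning

  conn-submodular : ∀ A B → conn M (A ∪ B) + conn M (A ∩ B) ≤ℤ conn M A + conn M B
  conn-submodular A B = begin
    conn M (A ∪ B) + conn M (A ∩ B)
      ≡⟨ cong₂ (λ X Y → (rk M (A ∪ B) + rk M X - rM M) + (rk M (A ∩ B) + rk M Y - rM M))
               (deMorgan₂ A B) (deMorgan₁ A B) ⟩
    (rk M (A ∪ B) + rk M (∁ A ∩ ∁ B) - rM M) + (rk M (A ∩ B) + rk M (∁ A ∪ ∁ B) - rM M)
      ≡⟨ regroup (rk M (A ∪ B)) (rk M (∁ A ∩ ∁ B)) (rk M (A ∩ B)) (rk M (∁ A ∪ ∁ B)) (rM M) ⟩
    (rk M (A ∪ B) + rk M (A ∩ B)) + (rk M (∁ A ∪ ∁ B) + rk M (∁ A ∩ ∁ B)) - (rM M + rM M)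
      ≤⟨ +-monoˡ-≤ (- (rM M + rM M)) (+-mono-≤ (rk-submodular A B) (rk-submodular (∁ A) (∁ B))) ⟩
    (rk M A + rk M B) + (rk M (∁ A) + rk M (∁ B)) - (rM M + rM M)
      ≡⟨ ungroup (rk M A) (rk M B) (rk M (∁ A)) (rk M (∁ B)) (rM M) ⟩
    conn M A + conn M B
      ∎
    where
    open ≤-Reasoning
    regroup : ∀ a b c d e → (a + b - e) + (c + d - e) ≡ (a + c) + (d + b) - (e + e)
    regroup = solve-∀
    ungroup : ∀ a c b d e → (a + c) + (b + d) - (e + e) ≡ (a + b - e) + (c + d - e)
    ungroup = solve-∀

  ⊓+⊓*≡conn : ∀ {X Y} → Disjoint X Y → ⊓ M X Y + ⊓* M X Y ≡ conn M X + conn M Y - conn M (X ∪ Y)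
  ⊓+⊓*≡conn {X} {Y} X#Y = begin
    ⊓ M X Y + (rk* M X + rk* M Y - (+ ∣ X ∪ Y ∣ + rk M (∁ (X ∪ Y)) - rM M))
      ≡⟨ cong (λ k → ⊓ M X Y + (rk* M X + rk* M Y - (k + rk M (∁ (X ∪ Y)) - rM M))) ∣X∪Y∣≡ ⟩
    ⊓ M X Y + (rk* M X + rk* M Y - (+ ∣ X ∣ + + ∣ Y ∣ + rk M (∁ (X ∪ Y)) - rM M))
      ≡⟨ cardinalities-cancel (+ ∣ X ∣) (+ ∣ Y ∣) (rk M X) (rk M (∁ X)) (rk M Y) (rk M (∁ Y))
                              (rk M (X ∪ Y)) (rk M (∁ (X ∪ Y))) (rM M) ⟩
    conn M X + conn M Y - conn M (X ∪ Y)
      ∎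
    where
    open ≡-Reasoning
    ∣X∪Y∣≡ : + ∣ X ∪ Y ∣ ≡ + ∣ X ∣ + + ∣ Y ∣
    ∣X∪Y∣≡ = trans (cong +_ (Disjoint⇒∣p∪q∣≡∣p∣+∣q∣ X#Y)) (pos-+ ∣ X ∣ ∣ Y ∣)
    cardinalities-cancel : ∀ x y a a' b b' u u' e →
      (a + b - u) + ((x + a' - e) + (y + b' - e) - ((x + y) + u' - e)) ≡
      (a + a' - e) + (b + b' - e) - (u + u' - e)
    cardinalities-cancel = solve-∀

  ⊓+⊓*≤conn : ∀ {L R S} → Disjoint L R → Disjoint S L → Disjoint S R →
    ⊓ M L R + ⊓* M L R ≤ℤ conn M L + conn M (L ∪ S) - conn M S
  ⊓+⊓*≤conn {L} {R} {S} L#R S#L S#R = begin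
    ⊓ M L R + ⊓* M L R                       ≡⟨ ⊓+⊓*≡conn L#R ⟩
    conn M L + conn M R - conn M (L ∪ R)      ≡⟨ +-assoc (conn M L) (conn M R) (- conn M (L ∪ R)) ⟩
    conn M L + (conn M R - conn M (L ∪ R))    ≡⟨ cong₂ (λ A B → conn M L + (A - B)) conn-R conn-L∪R ⟩
    conn M L + (conn M (F ∪ (L ∪ S)) - conn M F)
      ≤⟨ +-monoʳ-≤ (conn M L) (i+j≤k+l⇒i-k≤l-j {i = conn M (F ∪ (L ∪ S))} {k = conn M F} submodular) ⟩
    conn M L + (conn M (L ∪ S) - conn M S)    ≡⟨ +-assoc (conn M L) (conn M (L ∪ S)) (- conn M S) ⟨
    conn M L + conn M (L ∪ S) - conn M S      ∎
    where
    open ≤-Reasoning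
    F : Subset m
    F = ∁ (L ∪ R)
    conn-R : conn M R ≡ conn M (F ∪ (L ∪ S))
    conn-R = trans (sym (conn-∁ R)) (cong (conn M) (sym (∁[L∪R]∪[L∪S]≡∁R L#R S#L S#R)))
    conn-L∪R : conn M (L ∪ R) ≡ conn M F
    conn-L∪R = sym (conn-∁ (L ∪ R))
    submodular : conn M (F ∪ (L ∪ S)) + conn M S ≤ℤ conn M F + conn M (L ∪ S)
    submodular = subst (λ T → conn M (F ∪ (L ∪ S)) + conn M T ≤ℤ conn M F + conn M (L ∪ S))
                       (∁[L∪R]∩[L∪S]≡S L#R S#L S#R) (conn-submodular F (L ∪ S))

  path4-⊓+⊓*≤ : ∀ {k L R} {P : Fin (suc (suc k)) → Subset m} → IsPath4 M L P R →
    ⊓ M L R + ⊓* M L R ≤ℤ + 3 + + 3 - conn M (P fzero ∪ P (fsuc fzero))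
  path4-⊓+⊓*≤ {L = L} {R} {P} ((L#R , P#L , P#R , _) , _ , conn-prefix) = begin
    ⊓ M L R + ⊓* M L R                    ≤⟨ ⊓+⊓*≤conn L#R S#L S#R ⟩
    conn M L + conn M (L ∪ S) - conn M S  ≡⟨ cong₂ (λ a b → a + b - conn M S) conn-L conn-L∪S ⟩
    + 3 + + 3 - conn M S                  ∎
    where
    open ≤-Reasoning
    S : Subset m
    S = P fzero ∪ P (fsuc fzero)
    S#L : Disjoint S L
    S#L = Disjoint-∪ˡ (λ x → P#L x fzero) (λ x → P#L x (fsuc fzero))
    S#R : Disjoint S R
    S#R = Disjoint-∪ˡ (λ x → P#R x fzero) (λ x → P#R x (fsuc fzero))
    conn-L : conn M L ≡ + 3
    conn-L = subst (λ A → conn M A ≡ + 3)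
                   (trans (cong (L ∪_) (firsts[0]≡∅ P)) (∪-identityʳ L)) (conn-prefix 0 z≤n)
    conn-L∪S : conn M (L ∪ S) ≡ + 3
    conn-L∪S = subst (λ A → conn M (L ∪ A) ≡ + 3)
                     (firsts[2]≡P₀∪P₁ P) (conn-prefix 2 (s≤s (s≤s z≤n)))

lemma4p4 : ∀ {m : ℕ} (M : Matroid m) (c : ℕ) → 1 ≤ c →
    ∀ (n : ℕ) (L R : Subset m) (Q : Fin n → Subset m) →
    IsFlexipath4c M c L Q R → 2 ≤ n →
    ⊓ M L R + ⊓* M L R ≤ℤ + 5 - + c
lemma4p4 {m} M c _ _ L R Q (flexipath , _ , conn-Q∪Q) (s≤s (s≤s z≤n)) = begin
  ⊓ M L R + ⊓* M L R       ≤⟨ path4-⊓+⊓*≤ M (flexipath id) ⟩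
  + 3 + + 3 - conn M S     ≤⟨ +-monoʳ-≤ (+ 3 + + 3) (neg-mono-≤ (i<j⇒suc[i]≤j c<conn-S)) ⟩
  + 3 + + 3 - (1ℤ + + c)   ≡⟨ six-minus-suc (+ c) ⟩
  + 5 - + c                ∎
  where
  open ≤-Reasoning
  S : Subset m
  S = Q fzero ∪ Q (fsuc fzero)
  c<conn-S : + c < conn M S
  c<conn-S = conn-Q∪Q fzero (fsuc fzero) λ ()
  six-minus-suc : ∀ x → + 3 + + 3 - (1ℤ + x) ≡ + 5 - x
  six-minus-suc = solve-∀
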